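{- Screewidth is not minor monotone: there exist graphs $G$ and $H$ such that $H$ is a minor of $G$ and $\mathrm{scw}(H)>\mathrm{scw}(G)$.
   Context: All graphs are finite connected multigraphs (multiple edges allowed, no loops). A minor of $G$ is a graph obtained from $G$ by a sequence of edge deletions, vertex deletions and edge contractions. Screewidth: a tree-cut decomposition of $G$ is a pair $(T,\mathcal{X})$ with $T$ a tree (vertices = nodes, edges = links) and $\mathcal{X}=\{X_b: b\in V(T)\}$ pairwise disjoint, possibly empty subsets of $V(G)$ (bags) with union $V(G)$. For a link $l$, $\mathrm{adh}(l)$ is the set of edges of $G$ with endpoints in bags $X_b,X_d$ where $b,d$ lie in different components of $T-l$; for a node $b$, $\mathrm{adh}(b)$ is the set of edges of $G$ with endpoints in bags $X_c,X_d$ where $c,d$ lie in different components of $T-b$. The width is $\max\{\max_l|\mathrm{adh}(l)|,\ \max_b(|X_b|+|\mathrm{adh}(b)|)\}$, and $\mathrm{scw}(G)$ is the minimum width over all tree-cut decompositions of $G$. -}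

module Defs where

open import Data.Nat using (ℕ; zero; suc; _+_; _≤_; _<_)
open import Data.Fin using (Fin; punchOut; splitAt) renaming (_≟_ to _≟ᶠ_)
open import Data.List using (List; length; lookup; removeAt; filter; map)
open import Data.List.Membership.Propositional using (_∈_)
open import Data.List.Relation.Unary.All using (All)
open import Data.Product using (Σ; _×_; _,_; proj₁; proj₂)
open import Data.Sum using (_⊎_; [_,_])
open import Relation.Nullary using (¬_; yes; no; ¬?)
open import Relation.Binary.PropositionalEquality using (_≡_; _≢_; sym)
open import Function using (_∘_)

-- Finite multigraphs on vertex set Fin n: an edge is a pair of
-- endpoints; the edge list may contain repetitions (parallel edges).

Edge : ℕ → Set
Edge n = Fin n × Fin n

MG : ℕ → Set
MG n = List (Edge n)

Loopless : ∀ {n} → MG n → Set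
Loopless G = All (λ e → proj₁ e ≢ proj₂ e) G

data Reach {n : ℕ} (E : MG n) : Fin n → Fin n → Set where
  here  : ∀ {u} → Reach E u u
  fwd   : ∀ {u v w} → (u , v) ∈ E → Reach E v w → Reach E u w
  bwd   : ∀ {u v w} → (v , u) ∈ E → Reach E v w → Reach E u w

Connected : ∀ {n} → MG n → Set
Connected {n} G = (1 ≤ n) × (∀ u v → Reach G u v)

deleteEdge : ∀ {n} (G : MG n) → Fin (length G) → MG n
deleteEdge G i = removeAt G i

dropE : ∀ {m} → Fin (suc m) → Edge (suc m) → MG m
dropE v (x , y) with v ≟ᶠ x | v ≟ᶠ y
... | no v≢x | no v≢y = (punchOut v≢x , punchOut v≢y) List.∷ List.[]
  where import Data.List as List
... | _ | _ = List.[]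
  where import Data.List as List

deleteVertex : ∀ {m} (G : MG (suc m)) → Fin (suc m) → MG m
deleteVertex G v = Data.List.concatMap (dropE v) G
  where import Data.List

-- contracting an edge with endpoints u ≠ v: v is identified with u,
-- then v is removed from the vertex set; all edges between u and v
-- (which would become loops) are deleted.
mergeV : ∀ {m} (u v : Fin (suc m)) → u ≢ v → Fin (suc m) → Fin m
mergeV u v u≢v w with w ≟ᶠ v
... | yes _ = punchOut {i = v} {j = u} (u≢v ∘ sym)
... | no w≢v = punchOut {i = v} {j = w} (w≢v ∘ sym)

contractEdge : ∀ {m} (G : MG (suc m)) (i : Fin (length G)) →
               proj₁ (lookup G i) ≢ proj₂ (lookup G i) → MG m
contractEdge G i ne =
  filter (λ e → ¬? (proj₁ e ≟ᶠ proj₂ e))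
         (map (λ e → f (proj₁ e) , f (proj₂ e)) G)
  where f = mergeV (proj₁ (lookup G i)) (proj₂ (lookup G i)) ne

data _≼_ : ∀ {k n} → MG k → MG n → Set where
  ≼-refl  : ∀ {n} {G : MG n} → G ≼ G
  ≼-delE  : ∀ {k n} {H : MG k} {G : MG n} (i : Fin (length G)) →
            H ≼ deleteEdge G i → H ≼ G
  ≼-delV  : ∀ {k m} {H : MG k} {G : MG (suc m)} (v : Fin (suc m)) →
            H ≼ deleteVertex G v → H ≼ G
  ≼-contr : ∀ {k m} {H : MG k} {G : MG (suc m)} (i : Fin (length G))
            (ne : proj₁ (lookup G i) ≢ proj₂ (lookup G i)) →
            H ≼ contractEdge G i ne → H ≼ G

-- Cardinality bound: |{ i : Fin m | P i }| ≤ k, i.e. there is an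
-- injection (on indices) of this subset into Fin k.

SubsetSize≤ : (m : ℕ) → (Fin m → Set) → ℕ → Set
SubsetSize≤ m P k =
  Σ (∀ i → P i → Fin k) λ f → ∀ i j (p : P i) (q : P j) → f i p ≡ f j q → i ≡ j

-- A tree on node set Fin t is a connected
-- graph with t - 1 links (i.e. #links + 1 = t).  Bags are given by a
-- map assigning to each vertex of G the node whose bag contains it
-- (bags are thus pairwise disjoint, possibly empty, covering V(G)).

record TCD {n : ℕ} (G : MG n) : Set where
  field
    t          : ℕ
    links      : MG t
    treeConn   : Connected links
    treeCount  : length links + 1 ≡ t
    bag        : Fin n → Fin t

  AdhLink : Fin (length links) → Fin (length G) → Set
  AdhLink l e = ¬ Reach (removeAt links l) (bag (proj₁ (lookup G e)))
                                            (bag (proj₂ (lookup G e)))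

  linksAvoid : Fin t → MG t
  linksAvoid b = filter (λ e → ¬? (b ≟ᶠ proj₁ e)) (filter (λ e → ¬? (b ≟ᶠ proj₂ e)) links)

  AdhNode : Fin t → Fin (length G) → Set
  AdhNode b e = (bag (proj₁ (lookup G e)) ≢ b) × (bag (proj₂ (lookup G e)) ≢ b) ×
                ¬ Reach (linksAvoid b) (bag (proj₁ (lookup G e))) (bag (proj₂ (lookup G e)))

  -- X_b ⊎ adh(b), as a subset of Fin (n + |E(G)|)
  BagOrAdh : Fin t → Fin (n + length G) → Set
  BagOrAdh b j = [ (λ x → bag x ≡ b) , AdhNode b ] (splitAt n j)

  WidthAtMost : ℕ → Set
  WidthAtMost k = (∀ l → SubsetSize≤ (length G) (AdhLink l) k) ×
                  (∀ b → SubsetSize≤ (n + length G) (BagOrAdh b) k)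

HasScwAtMost : ∀ {n} → MG n → ℕ → Set
HasScwAtMost G k = Σ (TCD G) λ D → TCD.WidthAtMost D k

ScwIs : ∀ {n} → MG n → ℕ → Set
ScwIs G k = HasScwAtMost G k × (∀ m → HasScwAtMost G m → k ≤ m)

{-# OPTIONS --safe #-}
-- In G, vertices 0 and 3 are joined by three parallel edges, 1 and 2 by two, and the edges 2–3, 1–3
-- complete it.  The two-node decomposition with bags {0, 3} and {1, 2} has width 2: the link is
-- crossed only by 2–3 and 1–3.  Contracting 2–3 turns 1–3 into a third parallel 1–2 edge, giving
-- H = two triple edges 0–2 and 1–2.  In any tree-cut decomposition of H, either 0 or 1 lies in a
-- different bag from 2, and then some tree link separates those bags and carries three parallel
-- edges, or all three vertices share a bag; so scw(H) = 3.  The same dichotomy for 0 and 3 gives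
-- scw(G) ≥ 2.  That distinct tree nodes are separated by a link comes from the edge count: removing
-- a link from a tree leaves t − 2 edges, too few for a connected graph on t nodes.

module Submission where

open import Defs
open import Data.Nat using (ℕ; zero; suc; _+_; _≤_; _<_; z≤n; s≤s; _≤?_)
open import Data.Nat.Properties using (≤-refl; ≤-trans; n≤1+n; m≤n⇒m≤1+n; ≤⇒≯; n<1+n; ≰⇒>; m≤n+m)
open import Data.Fin using (Fin; zero; suc; #_; punchIn; splitAt; _↑ˡ_; _↑ʳ_)
  renaming (_≟_ to _≟ᶠ_)
open import Data.Fin.Properties
  using (punchOut-cong; punchOut-punchIn; punchInᵢ≢i; pigeonhole; <⇒≢; all?; suc-injective; ↑ˡ-injective; splitAt-↑ˡ; ↑ʳ-injective)
open import Data.List using (List; []; _∷_; length; lookup; removeAt; map)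
open import Data.List.Properties using (length-removeAt′; length-map)
open import Data.List.Membership.Propositional using (_∈_)
open import Data.List.Membership.Propositional.Properties using (∈-map⁺)
open import Data.List.Relation.Unary.All using ([]; _∷_)
open import Data.List.Relation.Unary.Any using (here; there; index)
open import Data.List.Relation.Unary.Any.Properties using (lookup-index)
open import Data.Product using (Σ; _×_; _,_; proj₁; proj₂)
open import Data.Product.Properties using (,-injectiveˡ; ,-injectiveʳ)
open import Data.Sum using (_⊎_; inj₁; inj₂; [_,_]; [_,_]′)
open import Data.Empty using (⊥-elim)
open import Function using (_∘_; id)
open import Relation.Nullary using (¬_; Dec; yes; no; ¬?)
open import Relation.Nullary.Decidable using (True; toWitness; _→-dec_; _×-dec_)
open import Relation.Unary using (Decidable)
open import Relation.Binary.PropositionalEquality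
  using (_≡_; _≢_; refl; sym; trans; cong; subst; subst₂)

module _ {n : ℕ} {E : MG n} where

  Reach-trans : ∀ {u v w} → Reach E u v → Reach E v w → Reach E u w
  Reach-trans here      r = r
  Reach-trans (fwd e p) r = fwd e (Reach-trans p r)
  Reach-trans (bwd e p) r = bwd e (Reach-trans p r)

  Reach-sym : ∀ {u v} → Reach E u v → Reach E v u
  Reach-sym here      = here
  Reach-sym (fwd e p) = Reach-trans (Reach-sym p) (bwd e here)
  Reach-sym (bwd e p) = Reach-trans (Reach-sym p) (fwd e here)

  walkLength : ∀ {u v} → Reach E u v → ℕ
  walkLength here      = 0
  walkLength (fwd _ p) = suc (walkLength p)
  walkLength (bwd _ p) = suc (walkLength p)

  ¬Reach⇒≢ : ∀ {u v} → ¬ Reach E u v → u ≢ v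
  ¬Reach⇒≢ nr refl = nr here

connectedVia : ∀ {n} {E : MG n} (h : Fin n) → (∀ u → Reach E u h) → ∀ u v → Reach E u v
connectedVia h r u v = Reach-trans (r u) (Reach-sym (r v))

∈-removeAt⁻ : ∀ {A : Set} {x : A} (xs : List A) (i : Fin (length xs)) → x ∈ xs →
              x ≡ lookup xs i ⊎ x ∈ removeAt xs i
∈-removeAt⁻ (y ∷ ys) zero    (here p)  = inj₁ p
∈-removeAt⁻ (y ∷ ys) zero    (there p) = inj₂ p
∈-removeAt⁻ (y ∷ ys) (suc i) (here p)  = inj₂ (here p)
∈-removeAt⁻ (y ∷ ys) (suc i) (there p) with ∈-removeAt⁻ ys i p
... | inj₁ q = inj₁ q
... | inj₂ q = inj₂ (there q)

NonLoop : ∀ {n} (E : MG n) → Fin (length E) → Set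
NonLoop E i = proj₁ (lookup E i) ≢ proj₂ (lookup E i)

walk⇒nonLoop : ∀ {n} {E : MG n} {u v} → Reach E u v → u ≢ v → Σ (Fin (length E)) (NonLoop E)
walk⇒nonLoop here ne = ⊥-elim (ne refl)
walk⇒nonLoop {u = u} (fwd {v = w} e p) ne with u ≟ᶠ w
... | yes refl = walk⇒nonLoop p ne
... | no u≢w   = index e , λ q →
  u≢w (trans (,-injectiveˡ (lookup-index e)) (trans q (sym (,-injectiveʳ (lookup-index e)))))
walk⇒nonLoop {u = u} (bwd {v = w} e p) ne with u ≟ᶠ w
... | yes refl = walk⇒nonLoop p ne
... | no u≢w   = index e , λ q →
  u≢w (trans (,-injectiveʳ (lookup-index e)) (trans (sym q) (sym (,-injectiveˡ (lookup-index e)))))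

mergeV-identifies : ∀ {m} (x y : Fin (suc m)) (x≢y : x ≢ y) → mergeV x y x≢y x ≡ mergeV x y x≢y y
mergeV-identifies x y x≢y with x ≟ᶠ y | y ≟ᶠ y
... | yes x≡y | _       = ⊥-elim (x≢y x≡y)
... | no _    | yes _   = punchOut-cong y refl
... | no _    | no y≢y  = ⊥-elim (y≢y refl)

mergeV-punchIn : ∀ {m} (x y : Fin (suc m)) (x≢y : x ≢ y) w → mergeV x y x≢y (punchIn y w) ≡ w
mergeV-punchIn x y x≢y w with punchIn y w ≟ᶠ y
... | yes eq = ⊥-elim (punchInᵢ≢i y w eq)
... | no _   = trans (punchOut-cong y refl) (punchOut-punchIn y)

mapEdge : ∀ {m n} → (Fin m → Fin n) → Edge m → Edge n
mapEdge f (a , b) = f a , f b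

module _ {m n} (E : MG m) (i : Fin (length E)) (f : Fin m → Fin n)
         (glue : f (proj₁ (lookup E i)) ≡ f (proj₂ (lookup E i))) where

  private
    glued : ∀ {a b} → (a , b) ≡ lookup E i → f a ≡ f b
    glued eq = trans (cong f (,-injectiveˡ eq)) (trans glue (cong f (sym (,-injectiveʳ eq))))

  Reach-glue : ∀ {a b} → Reach E a b → Reach (map (mapEdge f) (removeAt E i)) (f a) (f b)
  Reach-glue here = here
  Reach-glue {b = b} (fwd e p) with ∈-removeAt⁻ E i e
  ... | inj₁ eq = subst (λ z → Reach (map (mapEdge f) (removeAt E i)) z (f b))
                        (sym (glued eq)) (Reach-glue p)
  ... | inj₂ e′ = fwd (∈-map⁺ (mapEdge f) e′) (Reach-glue p)
  Reach-glue {b = b} (bwd e p) with ∈-removeAt⁻ E i e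
  ... | inj₁ eq = subst (λ z → Reach (map (mapEdge f) (removeAt E i)) z (f b))
                        (glued eq) (Reach-glue p)
  ... | inj₂ e′ = bwd (∈-map⁺ (mapEdge f) e′) (Reach-glue p)

connected⇒≤edges+1 : ∀ {t} (E : MG t) → (∀ u v → Reach E u v) → t ≤ length E + 1
connected⇒≤edges+1 {zero}        E conn = z≤n
connected⇒≤edges+1 {suc zero}    E conn = m≤n+m 1 (length E)
-- Contracting a non-loop edge removes one vertex and one edge and keeps the graph connected.
connected⇒≤edges+1 {suc (suc m)} E conn =
  subst (λ k → suc (suc m) ≤ k + 1) (sym E′-length) (s≤s (connected⇒≤edges+1 E′ conn′))
  where
  nonLoop = walk⇒nonLoop (conn zero (suc zero)) (λ ())
  i : Fin (length E)
  i = proj₁ nonLoop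
  x y : Fin (suc (suc m))
  x = proj₁ (lookup E i)
  y = proj₂ (lookup E i)
  f : Fin (suc (suc m)) → Fin (suc m)
  f = mergeV x y (proj₂ nonLoop)
  E′ : MG (suc m)
  E′ = map (mapEdge f) (removeAt E i)
  E′-length : length E ≡ suc (length E′)
  E′-length = trans (length-removeAt′ E i) (cong suc (sym (length-map (mapEdge f) (removeAt E i))))
  conn′ : ∀ u v → Reach E′ u v
  conn′ u v = subst₂ (Reach E′) (mergeV-punchIn x y _ u) (mergeV-punchIn x y _ v)
                (Reach-glue E i f (mergeV-identifies x y _) (conn (punchIn y u) (punchIn y v)))

Joins : ∀ {n} (E : MG n) → Fin (length E) → Fin n → Fin n → Set
Joins E l a b = lookup E l ≡ (a , b) ⊎ lookup E l ≡ (b , a)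

module _ {n : ℕ} (E : MG n) (conn : ∀ u v → Reach E u v) (l : Fin (length E)) where

  reaches-end-after-removal : ∀ w → Reach (removeAt E l) w (proj₁ (lookup E l)) ⊎
                                    Reach (removeAt E l) w (proj₂ (lookup E l))
  reaches-end-after-removal w = go (conn w (proj₁ (lookup E l))) (inj₁ here)
    where
    R = removeAt E l
    x = proj₁ (lookup E l)
    y = proj₂ (lookup E l)
    go : ∀ {w z} → Reach E w z → Reach R z x ⊎ Reach R z y → Reach R w x ⊎ Reach R w y
    go here h = h
    go (fwd e p) h with ∈-removeAt⁻ E l e | go p h
    ... | inj₁ eq | _      = inj₁ (subst (λ a → Reach R a x) (sym (,-injectiveˡ eq)) here)
    ... | inj₂ e′ | inj₁ r = inj₁ (fwd e′ r)
    ... | inj₂ e′ | inj₂ r = inj₂ (fwd e′ r)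
    go (bwd e p) h with ∈-removeAt⁻ E l e | go p h
    ... | inj₁ eq | _      = inj₂ (subst (λ a → Reach R a y) (sym (,-injectiveʳ eq)) here)
    ... | inj₂ e′ | inj₁ r = inj₁ (bwd e′ r)
    ... | inj₂ e′ | inj₂ r = inj₂ (bwd e′ r)

  -- Otherwise removeAt E l would be connected with only n − 2 edges.
  tree-removal-separates-ends : length E + 1 ≡ n →
                                ¬ Reach (removeAt E l) (proj₁ (lookup E l)) (proj₂ (lookup E l))
  tree-removal-separates-ends size x⇝y =
    ≤⇒≯ (connected⇒≤edges+1 R connR) (subst (length R + 1 <_) size′ (n<1+n (length R + 1)))
    where
    R = removeAt E l
    size′ : suc (length R) + 1 ≡ n
    size′ = trans (cong (_+ 1) (sym (length-removeAt′ E l))) size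
    toX : ∀ w → Reach R w (proj₁ (lookup E l))
    toX w = [ id , (λ w⇝y → Reach-trans w⇝y (Reach-sym x⇝y)) ]′ (reaches-end-after-removal w)
    connR : ∀ u v → Reach R u v
    connR = connectedVia _ toX

  tree-removal-disconnects : length E + 1 ≡ n → ∀ {a b} → Joins E l a b → ¬ Reach (removeAt E l) a b
  tree-removal-disconnects size (inj₁ refl) = tree-removal-separates-ends size
  tree-removal-disconnects size (inj₂ refl) = tree-removal-separates-ends size ∘ Reach-sym

-- The walk has to cross l, and it can only do so from v to p.
walk-across : ∀ {n} (E : MG n) (l : Fin (length E)) {v p} → Joins E l v p → ¬ Reach (removeAt E l) v p →
              ∀ {u q} (W : Reach E u q) → Reach (removeAt E l) v u → ¬ Reach (removeAt E l) v q →
              Σ (Reach E p q) λ W′ → walkLength W′ ≤ walkLength W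
walk-across E l joins apart here v⇝u v↛q = ⊥-elim (v↛q v⇝u)
walk-across E l joins apart (fwd e W) v⇝u v↛q with ∈-removeAt⁻ E l e
... | inj₂ e′ =
  let (W′ , W′≤W) = walk-across E l joins apart W (Reach-trans v⇝u (fwd e′ here)) v↛q in W′ , m≤n⇒m≤1+n W′≤W
... | inj₁ eq with joins
...   | inj₂ l≡pv = ⊥-elim (apart (subst (Reach _ _) (,-injectiveˡ (trans eq l≡pv)) v⇝u))
...   | inj₁ l≡vp with trans eq l≡vp
...     | refl = W , n≤1+n _
walk-across E l joins apart (bwd e W) v⇝u v↛q with ∈-removeAt⁻ E l e
... | inj₂ e′ =
  let (W′ , W′≤W) = walk-across E l joins apart W (Reach-trans v⇝u (bwd e′ here)) v↛q in W′ , m≤n⇒m≤1+n W′≤W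
... | inj₁ eq with joins
...   | inj₁ l≡vp = ⊥-elim (apart (subst (Reach _ _) (,-injectiveʳ (trans eq l≡vp)) v⇝u))
...   | inj₂ l≡pv with trans eq l≡pv
...     | refl = W , n≤1+n _

module _ {t : ℕ} (T : MG t) (conn : ∀ u v → Reach T u v) (size : length T + 1 ≡ t) where

  Separated : Fin t → Fin t → Set
  Separated p q = Σ (Fin (length T)) λ l → ¬ Reach (removeAt T l) p q

  -- Induction on a length bound k: walk-across returns a walk that is shorter but not a subterm.
  separated-by-walk : ∀ k {p q} (W : Reach T p q) → walkLength W ≤ k → p ≡ q ⊎ Separated p q
  separated-by-walk k       here      _ = inj₁ refl
  separated-by-walk zero    (fwd e W) ()
  separated-by-walk zero    (bwd e W) ()
  separated-by-walk (suc k) (fwd e W) (s≤s W≤k) with separated-by-walk k W W≤k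
  ... | inj₁ refl = inj₂ (index e , tree-removal-disconnects T conn (index e) size (inj₁ (sym (lookup-index e))))
  ... | inj₂ (l , w↛q) with ∈-removeAt⁻ T l e
  ...   | inj₂ e′ = inj₂ (l , w↛q ∘ bwd e′)
  ...   | inj₁ eq =
    let joins = inj₂ (sym eq)
        (W′ , W′≤W) = walk-across T l joins (tree-removal-disconnects T conn l size joins) W here w↛q
    in separated-by-walk k W′ (≤-trans W′≤W W≤k)
  separated-by-walk (suc k) (bwd e W) (s≤s W≤k) with separated-by-walk k W W≤k
  ... | inj₁ refl = inj₂ (index e , tree-removal-disconnects T conn (index e) size (inj₂ (sym (lookup-index e))))
  ... | inj₂ (l , w↛q) with ∈-removeAt⁻ T l e
  ...   | inj₂ e′ = inj₂ (l , w↛q ∘ fwd e′)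
  ...   | inj₁ eq =
    let joins = inj₁ (sym eq)
        (W′ , W′≤W) = walk-across T l joins (tree-removal-disconnects T conn l size joins) W here w↛q
    in separated-by-walk k W′ (≤-trans W′≤W W≤k)

  separatingLink : ∀ {p q} → p ≢ q → Separated p q
  separatingLink {p} {q} p≢q with separated-by-walk _ (conn p q) ≤-refl
  ... | inj₁ p≡q = ⊥-elim (p≢q p≡q)
  ... | inj₂ sep = sep

SubsetSize≤⇒≥ : ∀ {m k r} {P : Fin m → Set} → SubsetSize≤ m P k →
                (g : Fin r → Fin m) → (∀ i j → g i ≡ g j → i ≡ j) → (∀ i → P (g i)) → r ≤ k
SubsetSize≤⇒≥ {k = k} {r} (f , f-inj) g g-inj Pg with r ≤? k
... | yes r≤k = r≤k
... | no r≰k with pigeonhole (≰⇒> r≰k) (λ i → f (g i) (Pg i))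
... | i , j , i<j , fgi≡fgj = ⊥-elim (<⇒≢ i<j (g-inj i j (f-inj (g i) (g j) (Pg i) (Pg j) fgi≡fgj)))

InjectiveOn : ∀ {m k} → (Fin m → Set) → (Fin m → Fin k) → Set
InjectiveOn Q φ = ∀ i j → Q i → Q j → φ i ≡ φ j → i ≡ j

injectiveOn? : ∀ {m k} {Q : Fin m → Set} → Decidable Q → (φ : Fin m → Fin k) → Dec (InjectiveOn Q φ)
injectiveOn? Q? φ = all? λ i → all? λ j → Q? i →-dec (Q? j →-dec ((φ i ≟ᶠ φ j) →-dec (i ≟ᶠ j)))

SubsetSize≤-byInjection : ∀ {m k} {P Q : Fin m → Set} (φ : Fin m → Fin k) →
                          (∀ i → P i → Q i) → InjectiveOn Q φ → SubsetSize≤ m P k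
SubsetSize≤-byInjection φ P⊆Q φ-inj = (λ i _ → φ i) , λ i j Pi Pj → φ-inj i j (P⊆Q i Pi) (P⊆Q j Pj)

module _ {n : ℕ} {G : MG n} (D : TCD G) where
  open TCD D

  Crossing : Fin (length G) → Set
  Crossing e = bag (proj₁ (lookup G e)) ≢ bag (proj₂ (lookup G e))

  crossing? : Decidable Crossing
  crossing? e = ¬? (bag (proj₁ (lookup G e)) ≟ᶠ bag (proj₂ (lookup G e)))

  -- Decidable over-approximation of X_b ⊎ adh(b): separation in T − b is weakened to lying in different bags.
  NodeLoad : Fin t → Fin (n + length G) → Set
  NodeLoad b j = [ (λ x → bag x ≡ b) ,
                   (λ e → bag (proj₁ (lookup G e)) ≢ b × bag (proj₂ (lookup G e)) ≢ b × Crossing e) ]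
                 (splitAt n j)

  nodeLoad? : ∀ b → Decidable (NodeLoad b)
  nodeLoad? b j with splitAt n j
  ... | inj₁ x = bag x ≟ᶠ b
  ... | inj₂ e = ¬? (bag (proj₁ (lookup G e)) ≟ᶠ b) ×-dec ¬? (bag (proj₂ (lookup G e)) ≟ᶠ b) ×-dec crossing? e

  adhLink⇒crossing : ∀ l e → AdhLink l e → Crossing e
  adhLink⇒crossing l e = ¬Reach⇒≢

  bagOrAdh⇒nodeLoad : ∀ b j → BagOrAdh b j → NodeLoad b j
  bagOrAdh⇒nodeLoad b j with splitAt n j
  ... | inj₁ x = id
  ... | inj₂ e = λ (b≢s , b≢t , s↛t) → b≢s , b≢t , ¬Reach⇒≢ s↛t

  widthAtMost-byCounting : ∀ {k} (φL : Fin (length G) → Fin k) (φN : Fin t → Fin (n + length G) → Fin k) →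
                           {True (injectiveOn? crossing? φL)} →
                           {True (all? λ b → injectiveOn? (nodeLoad? b) (φN b))} →
                           WidthAtMost k
  widthAtMost-byCounting φL φN {φL-inj} {φN-inj} =
    (λ l → SubsetSize≤-byInjection φL (adhLink⇒crossing l) (toWitness φL-inj)) ,
    (λ b → SubsetSize≤-byInjection (φN b) (bagOrAdh⇒nodeLoad b) (toWitness φN-inj b))

  width≥parallelEdges : ∀ {k r} → WidthAtMost k → ∀ {u v} → bag u ≢ bag v →
                        (g : Fin r → Fin (length G)) → (∀ i j → g i ≡ g j → i ≡ j) →
                        (∀ i → lookup G (g i) ≡ (u , v)) → r ≤ k
  width≥parallelEdges (linkWidth , _) bu≢bv g g-inj g-uv =
    SubsetSize≤⇒≥ (linkWidth l) g g-inj λ i →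
      subst (λ e → ¬ Reach (removeAt links l) (bag (proj₁ e)) (bag (proj₂ e))) (sym (g-uv i)) apart
    where
    sep = separatingLink links (proj₂ treeConn) treeCount bu≢bv
    l = proj₁ sep
    apart = proj₂ sep

  width≥bag : ∀ {k r} → WidthAtMost k → ∀ {b} →
              (g : Fin r → Fin n) → (∀ i j → g i ≡ g j → i ≡ j) → (∀ i → bag (g i) ≡ b) → r ≤ k
  width≥bag (_ , nodeWidth) {b} g g-inj g-b =
    SubsetSize≤⇒≥ (nodeWidth b) (λ i → g i ↑ˡ length G) (λ i j → g-inj i j ∘ ↑ˡ-injective (length G) (g i) (g j))
      λ i → subst (λ s → [ (λ x → bag x ≡ b) , AdhNode b ] s) (sym (splitAt-↑ˡ n (g i) (length G))) (g-b i)

G : MG 4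
G = (# 2 , # 3) ∷ (# 0 , # 3) ∷ (# 0 , # 3) ∷ (# 0 , # 3) ∷ (# 1 , # 2) ∷ (# 1 , # 2) ∷ (# 1 , # 3) ∷ []

H : MG 3
H = (# 0 , # 2) ∷ (# 0 , # 2) ∷ (# 0 , # 2) ∷ (# 1 , # 2) ∷ (# 1 , # 2) ∷ (# 1 , # 2) ∷ []

H≼G : H ≼ G
H≼G = ≼-contr zero (λ ()) ≼-refl

G-loopless : Loopless G
G-loopless = (λ ()) ∷ (λ ()) ∷ (λ ()) ∷ (λ ()) ∷ (λ ()) ∷ (λ ()) ∷ (λ ()) ∷ []

H-loopless : Loopless H
H-loopless = (λ ()) ∷ (λ ()) ∷ (λ ()) ∷ (λ ()) ∷ (λ ()) ∷ (λ ()) ∷ []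

G-connected : Connected G
G-connected = s≤s z≤n , connectedVia (# 3) λ
  { zero                   → fwd (there (here refl)) here
  ; (suc zero)             → fwd (there (there (there (there (there (there (here refl))))))) here
  ; (suc (suc zero))       → fwd (here refl) here
  ; (suc (suc (suc zero))) → here
  }

H-connected : Connected H
H-connected = s≤s z≤n , connectedVia (# 2) λ
  { zero             → fwd (here refl) here
  ; (suc zero)       → fwd (there (there (there (here refl)))) here
  ; (suc (suc zero)) → here
  }

G-decomposition : TCD G
G-decomposition = record
  { t = 2
  ; links = (# 0 , # 1) ∷ []
  ; treeConn = s≤s z≤n , connectedVia (# 0) λ { zero → here ; (suc zero) → bwd (here refl) here }
  ; treeCount = refl
  ; bag = λ { zero → # 0 ; (suc zero) → # 1 ; (suc (suc zero)) → # 1 ; (suc (suc (suc zero))) → # 0 }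
  }

G-scw≤2 : HasScwAtMost G 2
G-scw≤2 = G-decomposition , widthAtMost-byCounting G-decomposition
  (λ { zero → # 0 ; _ → # 1 })
  (λ { _ zero → # 0 ; _ (suc zero) → # 0 ; _ _ → # 1 })

H-decomposition : TCD H
H-decomposition = record
  { t = 1
  ; links = []
  ; treeConn = s≤s z≤n , λ { zero zero → here }
  ; treeCount = refl
  ; bag = λ _ → # 0
  }

H-scw≤3 : HasScwAtMost H 3
H-scw≤3 = H-decomposition , widthAtMost-byCounting H-decomposition
  (λ _ → # 0)
  (λ { _ zero → # 0 ; _ (suc zero) → # 1 ; _ _ → # 2 })

G-scw≥2 : ∀ m → HasScwAtMost G m → 2 ≤ m
G-scw≥2 _ (D , width) with TCD.bag D (# 0) ≟ᶠ TCD.bag D (# 3)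
... | no  apart = width≥parallelEdges D width apart (λ i → suc (i ↑ˡ 4))
                    (λ i j → ↑ˡ-injective 4 i j ∘ suc-injective) λ { zero → refl ; (suc zero) → refl }
... | yes same  = width≥bag D width ends ends-injective λ { zero → same ; (suc zero) → refl }
  where
  ends : Fin 2 → Fin 4
  ends zero       = # 0
  ends (suc zero) = # 3
  ends-injective : ∀ i j → ends i ≡ ends j → i ≡ j
  ends-injective zero       zero       _ = refl
  ends-injective (suc zero) (suc zero) _ = refl
  ends-injective zero       (suc zero) ()
  ends-injective (suc zero) zero       ()

H-scw≥3 : ∀ m → HasScwAtMost H m → 3 ≤ m
H-scw≥3 _ (D , width) with TCD.bag D (# 0) ≟ᶠ TCD.bag D (# 2) | TCD.bag D (# 1) ≟ᶠ TCD.bag D (# 2)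
... | no apart | _ = width≥parallelEdges D width apart (_↑ˡ 3) (↑ˡ-injective 3)
                      λ { zero → refl ; (suc zero) → refl ; (suc (suc zero)) → refl }
... | yes _ | no apart = width≥parallelEdges D width apart (3 ↑ʳ_) (↑ʳ-injective 3)
                      λ { zero → refl ; (suc zero) → refl ; (suc (suc zero)) → refl }
... | yes same₀ | yes same₁ = width≥bag D width id (λ _ _ → id)
                      λ { zero → same₀ ; (suc zero) → same₁ ; (suc (suc zero)) → refl }

mainTheorem17 : Σ ℕ λ n → Σ ℕ λ k → Σ (MG n) λ G → Σ (MG k) λ H →
    Loopless G × Connected G × Loopless H × Connected H × (H ≼ G) ×
    Σ ℕ λ sG → Σ ℕ λ sH → ScwIs G sG × ScwIs H sH × sG < sH
mainTheorem17 = 4 , 3 , G , H , G-loopless , G-connected , H-loopless , H-connected , H≼G ,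
  2 , 3 , (G-scw≤2 , G-scw≥2) , (H-scw≤3 , H-scw≥3) , n<1+n 2
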